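{- For every integer $n\geq 2$, the edge metric dimension of the crystal cubic carbon graph $CCS(n)$ is $\mathrm{edim}(CCS(n)) = 7^{n-2}\times 16$.
   Context: All graphs are finite, simple, connected and undirected; $d(u,v)$ denotes the shortest-path distance between vertices $u,v$. For an edge $e=ab$ and a vertex $h$, the distance is $d(e,h)=\min\{d(a,h),d(b,h)\}$. An ordered set $H$ of vertices of a graph $G=(V,E)$ is an edge metric generator (edge resolving set) if for every two distinct edges $e_1\neq e_2$ in $E$ there is a vertex $h\in H$ with $d(e_1,h)\neq d(e_2,h)$. The edge metric dimension $\mathrm{edim}(G)$ is the minimum cardinality of an edge metric generator of $G$. The crystal cubic carbon graphs $CCS(n)$ are defined recursively. $CCS(1)$ is a single cube, i.e. the graph of the 3-dimensional cube $Q_3$ (8 vertices of degree 3, 12 edges), called the central cube. For $n\geq 1$, $CCS(n+1)$ is obtained from $CCS(n)$ as follows: for every vertex $v$ of $CCS(n)$ of degree $3$, take a new disjoint copy of the cube graph $Q_3$ and add one edge (a bridge edge) joining $v$ to one vertex of this new cube. Thus $CCS(2)$ consists of the central cube with a new cube attached by a bridge edge at each of its 8 vertices, and $CCS(n)$ for $n\ge 2$ has $7^{n-2}\times 8$ outermost cubes (cubes added at the last step), and $7^{n-2}\times 8\times 7$ vertices of degree 3. -}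

module Defs where

open import Data.Nat using (ℕ; zero; suc; _≤_; _<_; _⊓_)
open import Data.Bool using (Bool; true; false; not; T; _∧_)
open import Data.Product using (Σ; ∃; ∃-syntax; _×_; _,_; proj₁; proj₂)
open import Data.Sum using (_⊎_)
open import Data.List using (List; length)
open import Data.List.Membership.Propositional using (_∈_)
open import Data.List.Relation.Unary.Unique.Propositional using (Unique)
open import Relation.Binary.PropositionalEquality using (_≡_; _≢_)
open import Relation.Nullary using (¬_)
open import Level using (suc; zero)

record Graph : Set₁ where
  field
    V   : Set
    Adj : V → V → Set

module _ (G : Graph) where
  open Graph G

  data Walk : V → V → ℕ → Set where
    here : ∀ {u} → Walk u u 0
    step : ∀ {u w v k} → Adj u w → Walk w v k → Walk u v (ℕ.suc k)

  Dist : V → V → ℕ → Set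
  Dist u v k = Walk u v k × (∀ m → Walk u v m → k ≤ m)

  Edge : Set
  Edge = Σ (V × V) λ ab → Adj (proj₁ ab) (proj₂ ab)

  SameEdge : Edge → Edge → Set
  SameEdge ((a , b) , _) ((c , d) , _) = (a ≡ c × b ≡ d) ⊎ (a ≡ d × b ≡ c)

  EdgeDist : Edge → V → ℕ → Set
  EdgeDist ((a , b) , _) h k =
    ∃[ ka ] ∃[ kb ] (Dist a h ka × Dist b h kb × k ≡ ka ⊓ kb)

  Distinguishes : V → Edge → Edge → Set
  Distinguishes h e₁ e₂ =
    ∃[ k₁ ] ∃[ k₂ ] (EdgeDist e₁ h k₁ × EdgeDist e₂ h k₂ × k₁ ≢ k₂)

  IsEdgeMetricGenerator : List V → Set
  IsEdgeMetricGenerator H =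
    ∀ e₁ e₂ → ¬ SameEdge e₁ e₂ → ∃[ h ] (h ∈ H × Distinguishes h e₁ e₂)

  -- edim(G) = k : minimum cardinality of an edge metric generator
  -- (sets of vertices represented by duplicate-free lists)
  EdgeMetricDimension : ℕ → Set
  EdgeMetricDimension k =
    (∃[ H ] (Unique H × length H ≡ k × IsEdgeMetricGenerator H))
    × (∀ H → Unique H → IsEdgeMetricGenerator H → k ≤ length H)

Corner : Set
Corner = Bool × Bool × Bool

data Q3Adj : Corner → Corner → Set where
  flip₁ : ∀ x y z → Q3Adj (x , y , z) (not x , y , z)
  flip₂ : ∀ x y z → Q3Adj (x , y , z) (x , not y , z)
  flip₃ : ∀ x y z → Q3Adj (x , y , z) (x , y , not z)

-- the corner of a newly added cube to which its bridge edge is attached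
c₀ : Corner
c₀ = (false , false , false)

isC₀ : Corner → Bool
isC₀ (x , y , z) = not x ∧ not y ∧ not z

-- Cubes of the crystal cubic carbon structure, indexed by their depth
-- (the step at which they were added; the central cube has depth 0).
-- A cube of depth d+1 is attached by a bridge edge at a corner c of a
-- cube p of depth d, where c must be a degree-3 vertex at that moment:
-- any corner of the central cube, and any corner other than the bridge
-- corner c₀ of a non-central cube.

data Cube : ℕ → Set
isFree : ∀ {d} → Cube d → Corner → Bool

data Cube where
  central : Cube 0
  child   : ∀ {d} (p : Cube d) (c : Corner) → T (isFree p c) → Cube (ℕ.suc d)

isFree central        c = true
isFree (child _ _ _)  c = not (isC₀ c)

record Pos : Set where
  constructor pos
  field
    depth  : ℕ
    cube   : Cube depth
    corner : Corner

data PAdj : Pos → Pos → Set where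
  cubeEdge : ∀ {d} {p : Cube d} {c c'} → Q3Adj c c' → PAdj (pos d p c) (pos d p c')
  bridge↓  : ∀ {d} {p : Cube d} {c} (f : T (isFree p c)) →
             PAdj (pos d p c) (pos (ℕ.suc d) (child p c f) c₀)
  bridge↑  : ∀ {d} {p : Cube d} {c} (f : T (isFree p c)) →
             PAdj (pos (ℕ.suc d) (child p c f) c₀) (pos d p c)

CCS : ℕ → Graph
CCS n = record
  { V   = Σ Pos (λ v → Pos.depth v < n)
  ; Adj = λ u v → PAdj (proj₁ u) (proj₁ v)
  }

-- Every vertex of CCS(n) is a corner of a cube, and a cube is named by its address:
-- the corners, from the central cube downwards, at which its ancestors carry the
-- next cube. The cubes form a tree, so distances are explicit in addresses, and every
-- edge is a local edge of one cube: one of its twelve edges or the bridge above it.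
-- The corners α = 001 and β = 010 of the 8·7ⁿ⁻² outermost cubes resolve all edges.
-- Two local edges of an outermost cube are told apart by its α, its β, or, through
-- its bridge, by a landmark in another branch; a local edge of an outermost cube is
-- within distance 1 of its α or β, while every other edge is at distance at least 2
-- from both. Below each free corner of an inner cube hang outermost cubes, whose α
-- corners act as landmarks at that corner, and a finite check on Q₃ provides a
-- corner that separates. Conversely, seen from outside an outermost cube its three
-- edges at c₀ are equally far, and any single corner of the cube fails to separate
-- two of them, so every edge metric generator meets each outermost cube twice.

module Submission where

open import Defs
open import Data.Bool using (Bool; true; false; not; T; if_then_else_)
open import Data.Bool.Properties using (T-irrelevant) renaming (_≟_ to _≟ᵇ_)
open import Data.Empty using (⊥; ⊥-elim)
open import Data.List
  using (List; []; _∷_; _++_; _∷ʳ_; [_]; length; concatMap; cartesianProduct; cartesianProductWith; initLast; _∷ʳ′_)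
open import Data.List.Properties
  using (++-assoc; ++-identityʳ; ++-conicalʳ; ++-cancelˡ; ∷ʳ-++; ∷ʳ-injective; ∷-injectiveˡ; ∷-injectiveʳ;
         length-++)
  renaming (≡-dec to ≡-decᴸ)
open import Data.List.Membership.Propositional using (_∈_; lose; find)
open import Data.List.Membership.Propositional.Properties
  using (∈-cartesianProduct⁺; ∈-cartesianProductWith⁺; ∈-∃++; ∈-++⁺ˡ; ∈-++⁺ʳ; ∈-++⁻;
         ∈-concatMap⁺; ∈-concatMap⁻)
open import Data.List.Relation.Binary.Subset.Propositional using (_⊆_)
open import Data.List.Relation.Unary.All as All using (All; all?)
import Data.List.Relation.Unary.All.Properties as All
open import Data.List.Relation.Unary.Any using (here; there; any?; satisfied)
import Data.List.Relation.Unary.AllPairs as AllPairs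
import Data.List.Relation.Unary.AllPairs.Properties as AllPairs
open import Data.List.Relation.Unary.Unique.Propositional using (Unique)
import Data.List.Relation.Unary.Unique.Propositional.Properties as Unique
import Data.List.Relation.Unary.Unique.DecPropositional as DecUnique
open import Data.Nat using (ℕ; zero; suc; _+_; _*_; _^_; _∸_; _⊓_; _≤_; _<_; z≤n; s≤s; z<s; _≟_; _≤?_; _<?_)
open import Data.Nat.Properties
open import Data.Product using (Σ; ∃; ∃₂; ∃-syntax; _×_; _,_; proj₁; proj₂)
open import Data.Product.Properties using (≡-dec)
open import Data.Sum using (_⊎_; inj₁; inj₂)
open import Data.Unit using (⊤; tt)
open import Relation.Binary.PropositionalEquality hiding ([_])
open import Relation.Nullary using (¬_; Dec; yes; no; does; ¬?)
open import Relation.Nullary.Decidable using (from-yes; decidable-stable; _×-dec_; _⊎-dec_; _→-dec_)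

length-∷ʳ : ∀ {A : Set} (L : List A) c → length (L ∷ʳ c) ≡ suc (length L)
length-∷ʳ L c = trans (length-++ L) (+-comm (length L) 1)

length-<-++∷ : ∀ {A : Set} (L : List A) c S → length L < length (L ++ c ∷ S)
length-<-++∷ L c S = subst (length L <_) (sym (length-++ L)) (m<m+n (length L) z<s)

++∷≢[] : ∀ {A : Set} (L : List A) c S → L ++ c ∷ S ≢ []
++∷≢[] L c S eq with () ← ++-conicalʳ L (c ∷ S) eq

module _ {A B : Set} (f : A → List B) where

  unique-concatMap : (∀ {a a' b} → b ∈ f a → b ∈ f a' → a ≡ a') → (∀ a → Unique (f a)) →
                     ∀ {L} → Unique L → Unique (concatMap f L)
  unique-concatMap owner unique-f unique-L = Unique.concat⁺ (All.map⁺ (All.tabulate λ {a} _ → unique-f a))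
    (AllPairs.map⁺ (AllPairs.map (λ a≢a' {_} (b∈ , b∈') → a≢a' (owner b∈ b∈')) unique-L))

  ∈-concatMap : ∀ {a b L} → a ∈ L → b ∈ f a → b ∈ concatMap f L
  ∈-concatMap a∈L b∈fa = ∈-concatMap⁺ f (lose a∈L b∈fa)

  length-concatMap : ∀ k → (∀ a → length (f a) ≡ k) → ∀ L → length (concatMap f L) ≡ length L * k
  length-concatMap k length-f []      = refl
  length-concatMap k length-f (a ∷ L) =
    trans (length-++ (f a)) (cong₂ _+_ (length-f a) (length-concatMap k length-f L))

unique⊆⇒length≤ : {A : Set} {xs ys : List A} → Unique xs → xs ⊆ ys → length xs ≤ length ys
unique⊆⇒length≤ {xs = []}     _                  _   = z≤n
unique⊆⇒length≤ {xs = x ∷ xs} (x∉xs AllPairs.∷ u) sub with as , bs , refl ← ∈-∃++ (sub (here refl)) =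
  subst (suc (length xs) ≤_) (sym length-ys) (s≤s (unique⊆⇒length≤ u sub'))
  where
  length-ys : length (as ++ x ∷ bs) ≡ suc (length (as ++ bs))
  length-ys = trans (length-++ as) (trans (+-suc (length as) (length bs)) (cong suc (sym (length-++ as))))
  sub' : xs ⊆ as ++ bs
  sub' {y} y∈xs with ∈-++⁻ as (sub (there y∈xs))
  ... | inj₁ y∈as          = ∈-++⁺ˡ y∈as
  ... | inj₂ (here refl)   = ⊥-elim (All.lookup x∉xs y∈xs refl)
  ... | inj₂ (there y∈bs)  = ∈-++⁺ʳ as y∈bs

unique-pair : {A : Set} {x y : A} → x ≢ y → Unique (x ∷ y ∷ [])
unique-pair x≢y = (x≢y All.∷ All.[]) AllPairs.∷ All.[] AllPairs.∷ AllPairs.[]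

everywhere : {A : Set} {P : A → Set} {xs : List A} → (∀ x → x ∈ xs) → All P xs → ∀ x → P x
everywhere complete ps x = All.lookup ps (complete x)

-- The cube Q₃

_≟ᶜ_ : (a b : Corner) → Dec (a ≡ b)
_≟ᶜ_ = ≡-dec _≟ᵇ_ (≡-dec _≟ᵇ_ _≟ᵇ_)

bitDist : Bool → Bool → ℕ
bitDist false false = 0
bitDist true  true  = 0
bitDist _     _     = 1

hamming : Corner → Corner → ℕ
hamming (x , y , z) (x' , y' , z') = bitDist x x' + bitDist y y' + bitDist z z'

weight : Corner → ℕ
weight = hamming c₀

bitDist-sym : ∀ a b → bitDist a b ≡ bitDist b a
bitDist-sym false false = refl
bitDist-sym false true  = refl
bitDist-sym true  false = refl
bitDist-sym true  true  = refl

bitDist-refl : ∀ a → bitDist a a ≡ 0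
bitDist-refl false = refl
bitDist-refl true  = refl

hamming-sym : ∀ a b → hamming a b ≡ hamming b a
hamming-sym (x , y , z) (x' , y' , z') =
  cong₂ _+_ (cong₂ _+_ (bitDist-sym x x') (bitDist-sym y y')) (bitDist-sym z z')

hamming-refl : ∀ a → hamming a a ≡ 0
hamming-refl (x , y , z) = cong₂ _+_ (cong₂ _+_ (bitDist-refl x) (bitDist-refl y)) (bitDist-refl z)

data Axis : Set where
  ax₁ ax₂ ax₃ : Axis

flip : Axis → Corner → Corner
flip ax₁ (x , y , z) = (not x , y , z)
flip ax₂ (x , y , z) = (x , not y , z)
flip ax₃ (x , y , z) = (x , y , not z)

flip-adj : ∀ i u → Q3Adj u (flip i u)
flip-adj ax₁ (x , y , z) = flip₁ x y z
flip-adj ax₂ (x , y , z) = flip₂ x y z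
flip-adj ax₃ (x , y , z) = flip₃ x y z

flip-involutive : ∀ i u → flip i (flip i u) ≡ u
flip-involutive ax₁ (true  , y , z) = refl
flip-involutive ax₁ (false , y , z) = refl
flip-involutive ax₂ (x , true  , z) = refl
flip-involutive ax₂ (x , false , z) = refl
flip-involutive ax₃ (x , y , true ) = refl
flip-involutive ax₃ (x , y , false) = refl

flip-≢ : ∀ i u → flip i u ≢ u
flip-≢ ax₁ (true  , y , z) ()
flip-≢ ax₁ (false , y , z) ()
flip-≢ ax₂ (x , true  , z) ()
flip-≢ ax₂ (x , false , z) ()
flip-≢ ax₃ (x , y , true ) ()
flip-≢ ax₃ (x , y , false) ()

flip-c₀-injective : ∀ i j → flip i c₀ ≡ flip j c₀ → i ≡ j
flip-c₀-injective ax₁ ax₁ _ = refl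
flip-c₀-injective ax₂ ax₂ _ = refl
flip-c₀-injective ax₃ ax₃ _ = refl

axisOf : ∀ {u v} → Q3Adj u v → Axis
axisOf (flip₁ _ _ _) = ax₁
axisOf (flip₂ _ _ _) = ax₂
axisOf (flip₃ _ _ _) = ax₃

axisOf-flip : ∀ {u v} (q : Q3Adj u v) → v ≡ flip (axisOf q) u
axisOf-flip (flip₁ _ _ _) = refl
axisOf-flip (flip₂ _ _ _) = refl
axisOf-flip (flip₃ _ _ _) = refl

_≟ᵃ_ : (i j : Axis) → Dec (i ≡ j)
ax₁ ≟ᵃ ax₁ = yes refl
ax₂ ≟ᵃ ax₂ = yes refl
ax₃ ≟ᵃ ax₃ = yes refl
ax₁ ≟ᵃ ax₂ = no λ ()
ax₁ ≟ᵃ ax₃ = no λ ()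
ax₂ ≟ᵃ ax₁ = no λ ()
ax₂ ≟ᵃ ax₃ = no λ ()
ax₃ ≟ᵃ ax₁ = no λ ()
ax₃ ≟ᵃ ax₂ = no λ ()

allAxes : List Axis
allAxes = ax₁ ∷ ax₂ ∷ ax₃ ∷ []

allAxes-complete : ∀ i → i ∈ allAxes
allAxes-complete ax₁ = here refl
allAxes-complete ax₂ = there (here refl)
allAxes-complete ax₃ = there (there (here refl))

allBools : List Bool
allBools = true ∷ false ∷ []

allBools-complete : ∀ b → b ∈ allBools
allBools-complete true  = here refl
allBools-complete false = there (here refl)

allCorners : List Corner
allCorners = cartesianProduct allBools (cartesianProduct allBools allBools)

allCorners-complete : ∀ c → c ∈ allCorners
allCorners-complete (x , y , z) =
  ∈-cartesianProduct⁺ (allBools-complete x) (∈-cartesianProduct⁺ (allBools-complete y) (allBools-complete z))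

-- Addresses and distances

infix 4 _≼_ _≼?_

_≟ᴬ_ : (A B : List Corner) → Dec (A ≡ B)
_≟ᴬ_ = ≡-decᴸ _≟ᶜ_

_≼_ : List Corner → List Corner → Set
P ≼ B = ∃ λ T → B ≡ P ++ T

_≼?_ : (P B : List Corner) → Dec (P ≼ B)
[]    ≼? B     = yes (B , refl)
p ∷ P ≼? []    = no λ { (_ , ()) }
p ∷ P ≼? b ∷ B with p ≟ᶜ b | P ≼? B
... | no p≢b    | _             = no λ { (_ , e) → p≢b (sym (∷-injectiveˡ e)) }
... | yes _     | no P⋠B        = no λ { (T , e) → P⋠B (T , ∷-injectiveʳ e) }
... | yes refl  | yes (T , e)   = yes (T , cong (p ∷_) e)

≼-length : ∀ {P B} → P ≼ B → length P ≤ length B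
≼-length {P} (T , refl) = subst (length P ≤_) (sym (length-++ P)) (m≤m+n (length P) (length T))

⋠-shorter : ∀ {P B} → length B < length P → ¬ P ≼ B
⋠-shorter B<P P≼B = <⇒≱ B<P (≼-length P≼B)

⋠-notLonger : ∀ {P B} → length B ≤ length P → B ≢ P → ¬ P ≼ B
⋠-notLonger {P} _   B≢P ([] , refl)    = B≢P (++-identityʳ P)
⋠-notLonger {P} B≤P _   (t ∷ T , refl) = <⇒≱ (length-<-++∷ P t T) B≤P

∷ʳ-⋠ : ∀ L c → ¬ L ∷ʳ c ≼ L
∷ʳ-⋠ L c = ⋠-shorter (length-<-++∷ L c [])

≼-trans : ∀ {P Q B} → P ≼ Q → Q ≼ B → P ≼ B
≼-trans {P} (T , refl) (T' , refl) = T ++ T' , ++-assoc P T T'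

∷ʳ-≼ : ∀ {P B} c → P ∷ʳ c ≼ B → P ≼ B
∷ʳ-≼ {P} c (T , refl) = c ∷ T , ∷ʳ-++ P c T

-- Corner y of the cube at address A is written (A , y); an address lists, from
-- the central cube downwards, the corners at which the successive cubes hang.
-- climb T y is the distance from (A ++ c ∷ T , y) up to (A , c), and dist A y B z
-- the distance from (A , y) to (B , z): the cubes form a tree, so a shortest path
-- climbs to the cube where the two addresses part, crosses it, and descends.
climb : List Corner → Corner → ℕ
climb []      y = suc (weight y)
climb (b ∷ B) y = suc (weight b) + climb B y

dist : List Corner → Corner → List Corner → Corner → ℕ
dist []      y []      z = hamming y z
dist []      y (b ∷ B) z = hamming y b + climb B z
dist (a ∷ A) y []      z = climb A y + hamming a z
dist (a ∷ A) y (b ∷ B) z =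
  if does (a ≟ᶜ b) then dist A y B z else climb A y + hamming a b + climb B z

dist-sym : ∀ A y B z → dist A y B z ≡ dist B z A y
dist-sym []      y []      z = hamming-sym y z
dist-sym []      y (b ∷ B) z = trans (cong (_+ climb B z) (hamming-sym y b)) (+-comm (hamming b y) (climb B z))
dist-sym (a ∷ A) y []      z = trans (+-comm (climb A y) (hamming a z)) (cong (_+ climb A y) (hamming-sym a z))
dist-sym (a ∷ A) y (b ∷ B) z with a ≟ᶜ b | b ≟ᶜ a
... | yes _   | yes _   = dist-sym A y B z
... | yes a≡b | no b≢a  = ⊥-elim (b≢a (sym a≡b))
... | no a≢b  | yes b≡a = ⊥-elim (a≢b (sym b≡a))
... | no _    | no _    = begin
  climb A y + hamming a b + climb B z   ≡⟨ cong (λ t → climb A y + t + climb B z) (hamming-sym a b) ⟩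
  climb A y + hamming b a + climb B z   ≡⟨ +-assoc (climb A y) (hamming b a) (climb B z) ⟩
  climb A y + (hamming b a + climb B z) ≡⟨ +-comm (climb A y) _ ⟩
  hamming b a + climb B z + climb A y   ≡⟨ cong (_+ climb A y) (+-comm (hamming b a) (climb B z)) ⟩
  climb B z + hamming b a + climb A y   ∎
  where open ≡-Reasoning

dist-self : ∀ A y z → dist A y A z ≡ hamming y z
dist-self []      y z = refl
dist-self (a ∷ A) y z with a ≟ᶜ a
... | yes _   = dist-self A y z
... | no  a≢a = ⊥-elim (a≢a refl)

dist-ancestor : ∀ A y c T z → dist A y (A ++ c ∷ T) z ≡ hamming y c + climb T z
dist-ancestor []      y c T z = refl
dist-ancestor (a ∷ A) y c T z with a ≟ᶜ a
... | yes _   = dist-ancestor A y c T z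
... | no  a≢a = ⊥-elim (a≢a refl)

climb-++ : ∀ A c T y → climb (A ++ c ∷ T) y ≡ climb T y + climb A c
climb-++ []      c T y = +-comm (suc (weight c)) (climb T y)
climb-++ (a ∷ A) c T y = begin
  suc (weight a) + climb (A ++ c ∷ T) y   ≡⟨ cong (suc (weight a) +_) (climb-++ A c T y) ⟩
  suc (weight a) + (climb T y + climb A c) ≡⟨ +-assoc (suc (weight a)) (climb T y) (climb A c) ⟨
  suc (weight a) + climb T y + climb A c   ≡⟨ cong (_+ climb A c) (+-comm (suc (weight a)) (climb T y)) ⟩
  climb T y + suc (weight a) + climb A c   ≡⟨ +-assoc (climb T y) (suc (weight a)) (climb A c) ⟩
  climb T y + (suc (weight a) + climb A c) ∎
  where open ≡-Reasoning

-- Every path from the subtree below (A , c) to a vertex outside it passes through (A , c).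
dist-below : ∀ A c T y B z → ¬ (A ∷ʳ c ≼ B) → dist (A ++ c ∷ T) y B z ≡ climb T y + dist A c B z
dist-below []      c T y []      z _ = refl
dist-below []      c T y (b ∷ B) z ∉ with c ≟ᶜ b
... | yes refl = ⊥-elim (∉ (B , refl))
... | no  _    = +-assoc (climb T y) (hamming c b) (climb B z)
dist-below (a ∷ A) c T y []      z _ = begin
  climb (A ++ c ∷ T) y + hamming a z   ≡⟨ cong (_+ hamming a z) (climb-++ A c T y) ⟩
  climb T y + climb A c + hamming a z  ≡⟨ +-assoc (climb T y) (climb A c) (hamming a z) ⟩
  climb T y + (climb A c + hamming a z) ∎
  where open ≡-Reasoning
dist-below (a ∷ A) c T y (b ∷ B) z ∉ with a ≟ᶜ b
... | yes refl = dist-below A c T y B z (λ { (T' , e) → ∉ (T' , cong (a ∷_) e) })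
... | no  _    = begin
  climb (A ++ c ∷ T) y + hamming a b + climb B z   ≡⟨ cong (λ t → t + hamming a b + climb B z) (climb-++ A c T y) ⟩
  climb T y + climb A c + hamming a b + climb B z
    ≡⟨ cong (_+ climb B z) (+-assoc (climb T y) (climb A c) (hamming a b)) ⟩
  climb T y + (climb A c + hamming a b) + climb B z ≡⟨ +-assoc (climb T y) (climb A c + hamming a b) (climb B z) ⟩
  climb T y + (climb A c + hamming a b + climb B z) ∎
  where open ≡-Reasoning

dist-belowʳ : ∀ B z L c T y → ¬ (L ∷ʳ c ≼ B) → dist B z (L ++ c ∷ T) y ≡ climb T y + dist B z L c
dist-belowʳ B z L c T y ∉ = begin
  dist B z (L ++ c ∷ T) y   ≡⟨ dist-sym B z (L ++ c ∷ T) y ⟩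
  dist (L ++ c ∷ T) y B z   ≡⟨ dist-below L c T y B z ∉ ⟩
  climb T y + dist L c B z  ≡⟨ cong (climb T y +_) (dist-sym L c B z) ⟩
  climb T y + dist B z L c  ∎
  where open ≡-Reasoning

Near : ℕ → ℕ → Set
Near m n = m ≤ suc n × n ≤ suc m

near-sym : ∀ {m n} → Near m n → Near n m
near-sym (p , q) = q , p

near-suc : ∀ m → Near m (suc m)
near-suc m = m≤n⇒m≤1+n (n≤1+n m) , ≤-refl

near-+ʳ : ∀ {m n} k → Near m n → Near (m + k) (n + k)
near-+ʳ k (p , q) = +-monoˡ-≤ k p , +-monoˡ-≤ k q

near-+ˡ : ∀ {m n} k → Near m n → Near (k + m) (k + n)
near-+ˡ {m} {n} k mn = subst₂ Near (+-comm m k) (+-comm n k) (near-+ʳ k mn)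

bitDist-not : ∀ x x' → Near (bitDist x x') (bitDist (not x) x')
bitDist-not false false = near-suc 0
bitDist-not false true  = near-sym (near-suc 0)
bitDist-not true  false = near-sym (near-suc 0)
bitDist-not true  true  = near-suc 0

hamming-adjˡ : ∀ {y y'} → Q3Adj y y' → ∀ z → Near (hamming y z) (hamming y' z)
hamming-adjˡ (flip₁ x y z) (x' , y' , z') = near-+ʳ (bitDist z z') (near-+ʳ (bitDist y y') (bitDist-not x x'))
hamming-adjˡ (flip₂ x y z) (x' , y' , z') = near-+ʳ (bitDist z z') (near-+ˡ (bitDist x x') (bitDist-not y y'))
hamming-adjˡ (flip₃ x y z) (x' , y' , z') = near-+ˡ (bitDist x x' + bitDist y y') (bitDist-not z z')

hamming-adjʳ : ∀ {y y'} → Q3Adj y y' → ∀ z → Near (hamming z y) (hamming z y')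
hamming-adjʳ {y} {y'} q z = subst₂ Near (hamming-sym y z) (hamming-sym y' z) (hamming-adjˡ q z)

climb-adj : ∀ {y y'} → Q3Adj y y' → ∀ A → Near (climb A y) (climb A y')
climb-adj q []      = near-+ˡ 1 (hamming-adjʳ q c₀)
climb-adj q (b ∷ B) = near-+ˡ (suc (weight b)) (climb-adj q B)

dist-cubeEdge : ∀ {y y'} → Q3Adj y y' → ∀ A B z → Near (dist A y B z) (dist A y' B z)
dist-cubeEdge q []      []      z = hamming-adjˡ q z
dist-cubeEdge q []      (b ∷ B) z = near-+ʳ (climb B z) (hamming-adjˡ q b)
dist-cubeEdge q (a ∷ A) []      z = near-+ʳ (hamming a z) (climb-adj q A)
dist-cubeEdge q (a ∷ A) (b ∷ B) z with a ≟ᶜ b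
... | yes _ = dist-cubeEdge q A B z
... | no  _ = near-+ʳ (climb B z) (near-+ʳ (hamming a b) (climb-adj q A))

dist-bridge : ∀ A c B z → Near (dist A c B z) (dist (A ∷ʳ c) c₀ B z)
dist-bridge A c B z with A ∷ʳ c ≼? B
... | no ∉ = subst (Near (dist A c B z)) (sym (dist-below A c [] c₀ B z ∉)) (near-suc (dist A c B z))
... | yes (T , refl) = subst (λ k → Near k (dist (A ∷ʳ c) c₀ (A ∷ʳ c ++ T) z)) (sym above) (below T)
  where
  above : dist A c (A ∷ʳ c ++ T) z ≡ climb T z
  above = begin
    dist A c (A ∷ʳ c ++ T) z   ≡⟨ cong (λ B → dist A c B z) (∷ʳ-++ A c T) ⟩
    dist A c (A ++ c ∷ T) z    ≡⟨ dist-ancestor A c c T z ⟩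
    hamming c c + climb T z    ≡⟨ cong (_+ climb T z) (hamming-refl c) ⟩
    climb T z                  ∎
    where open ≡-Reasoning
  below : ∀ T → Near (climb T z) (dist (A ∷ʳ c) c₀ (A ∷ʳ c ++ T) z)
  below []      rewrite ++-identityʳ (A ∷ʳ c) | dist-self (A ∷ʳ c) c₀ z = near-sym (near-suc (weight z))
  below (t ∷ T) rewrite dist-ancestor (A ∷ʳ c) c₀ t T z = near-sym (near-suc (weight t + climb T z))

-- Local edges

-- edge u i joins u and flip i u, and up is the bridge above the cube. Within a
-- cube X, cornerDist a c is the distance from (X , c) to a, and edgeClimb a the
-- distance from a to the corner from which X hangs.
data LocalEdge : Set where
  edge : Corner → Axis → LocalEdge
  up   : LocalEdge

SameLocalEdge : LocalEdge → LocalEdge → Set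
SameLocalEdge (edge u i) (edge v j) = i ≡ j × (v ≡ u ⊎ v ≡ flip i u)
SameLocalEdge up         up         = ⊤
SameLocalEdge _          _          = ⊥

sameLocalEdge? : ∀ a b → Dec (SameLocalEdge a b)
sameLocalEdge? (edge u i) (edge v j) = i ≟ᵃ j ×-dec (v ≟ᶜ u ⊎-dec v ≟ᶜ flip i u)
sameLocalEdge? (edge _ _) up         = no λ ()
sameLocalEdge? up         (edge _ _) = no λ ()
sameLocalEdge? up         up         = yes tt

isUp? : ∀ a → Dec (a ≡ up)
isUp? (edge _ _) = no λ ()
isUp? up         = yes refl

cornerDist : LocalEdge → Corner → ℕ
cornerDist (edge u i) c = hamming u c ⊓ hamming (flip i u) c
cornerDist up         c = weight c

edgeClimb : LocalEdge → ℕ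
edgeClimb (edge u i) = suc (weight u) ⊓ suc (weight (flip i u))
edgeClimb up         = 0

allLocalEdges : List LocalEdge
allLocalEdges = up ∷ cartesianProductWith edge allCorners allAxes

allLocalEdges-complete : ∀ a → a ∈ allLocalEdges
allLocalEdges-complete up         = here refl
allLocalEdges-complete (edge u i) =
  there (∈-cartesianProductWith⁺ edge (allCorners-complete u) (allAxes-complete i))

α β : Corner
α = (false , false , true)
β = (false , true , false)

-- Decided by evaluation over all local edges and corners, and opaque because
-- normalising these decision procedures again later is prohibitively slow.
opaque
  separated-by-α-β-climb : ∀ a b → ¬ SameLocalEdge a b →
    cornerDist a α ≢ cornerDist b α ⊎ cornerDist a β ≢ cornerDist b β ⊎ edgeClimb a ≢ edgeClimb b
  separated-by-α-β-climb a b = everywhere allLocalEdges-complete (everywhere allLocalEdges-complete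
    (from-yes (all? (λ a → all? (λ b → ¬? (sameLocalEdge? a b) →-dec
      (¬? (cornerDist a α ≟ cornerDist b α) ⊎-dec ¬? (cornerDist a β ≟ cornerDist b β) ⊎-dec
       ¬? (edgeClimb a ≟ edgeClimb b))) allLocalEdges) allLocalEdges)) a) b

  separated-by-free-corner : ∀ a b → ¬ SameLocalEdge a b → ∃ λ c → c ≢ c₀ × cornerDist a c ≢ cornerDist b c
  separated-by-free-corner a b a≁b = satisfied (everywhere allLocalEdges-complete (everywhere allLocalEdges-complete
    (from-yes (all? (λ a → all? (λ b → ¬? (sameLocalEdge? a b) →-dec
      any? (λ c → ¬? (c ≟ᶜ c₀) ×-dec ¬? (cornerDist a c ≟ cornerDist b c)) allCorners)
      allLocalEdges) allLocalEdges)) a) b a≁b)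

  near-α-or-β : ∀ a → cornerDist a α ≤ 1 ⊎ cornerDist a β ≤ 1
  near-α-or-β = everywhere allLocalEdges-complete
    (from-yes (all? (λ a → cornerDist a α ≤? 1 ⊎-dec cornerDist a β ≤? 1) allLocalEdges))

  nearer-than-branch : ∀ a b → (a ≡ up → b ≢ c₀) → ∃ λ c → c ≢ c₀ × c ≢ b × cornerDist a c < hamming b c
  nearer-than-branch a b up⇒b≢c₀ = satisfied (everywhere allCorners-complete (everywhere allLocalEdges-complete
    (from-yes (all? (λ a → all? (λ b → (isUp? a →-dec ¬? (b ≟ᶜ c₀)) →-dec
      any? (λ c → ¬? (c ≟ᶜ c₀) ×-dec ¬? (c ≟ᶜ b) ×-dec cornerDist a c <? hamming b c) allCorners)
      allCorners) allLocalEdges)) a) b up⇒b≢c₀)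

  within-weight : ∀ a → ∃ λ c → c ≢ c₀ × cornerDist a c ≤ weight c
  within-weight a = satisfied (everywhere allLocalEdges-complete
    (from-yes (all? (λ a → any? (λ c → ¬? (c ≟ᶜ c₀) ×-dec cornerDist a c ≤? weight c) allCorners)
      allLocalEdges)) a)

  c₀-edges-unseparated : ∀ z → ∃₂ λ i j → i ≢ j × cornerDist (edge c₀ i) z ≡ cornerDist (edge c₀ j) z
  c₀-edges-unseparated z with i , j∈ ← satisfied (everywhere allCorners-complete
    (from-yes (all? (λ z → any? (λ i → any? (λ j → ¬? (i ≟ᵃ j) ×-dec
      cornerDist (edge c₀ i) z ≟ cornerDist (edge c₀ j) z) allAxes) allAxes) allCorners)) z)
    = i , satisfied j∈

edgeClimb-c₀ : ∀ i → edgeClimb (edge c₀ i) ≡ 1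
edgeClimb-c₀ ax₁ = refl
edgeClimb-c₀ ax₂ = refl
edgeClimb-c₀ ax₃ = refl

-- The bridge above the cube at address P ∷ʳ a joins (P , a) to (P ∷ʳ a , c₀);
-- the central cube has none, and the values at [] are junk.
parentAddress : List Corner → List Corner
parentAddress []          = []
parentAddress (x ∷ [])    = []
parentAddress (x ∷ y ∷ X) = x ∷ parentAddress (y ∷ X)

attachCorner : List Corner → Corner
attachCorner []          = c₀
attachCorner (x ∷ [])    = x
attachCorner (x ∷ y ∷ X) = attachCorner (y ∷ X)

parentAddress-∷ʳ : ∀ P a → parentAddress (P ∷ʳ a) ≡ P
parentAddress-∷ʳ []          a = refl
parentAddress-∷ʳ (x ∷ [])    a = refl
parentAddress-∷ʳ (x ∷ y ∷ P) a = cong (x ∷_) (parentAddress-∷ʳ (y ∷ P) a)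

attachCorner-∷ʳ : ∀ P a → attachCorner (P ∷ʳ a) ≡ a
attachCorner-∷ʳ []          a = refl
attachCorner-∷ʳ (x ∷ [])    a = refl
attachCorner-∷ʳ (x ∷ y ∷ P) a = attachCorner-∷ʳ (y ∷ P) a

parentAddress-≼ : ∀ X → parentAddress X ≼ X
parentAddress-≼ X with initLast X
... | []     = [] , refl
... | P ∷ʳ′ a rewrite parentAddress-∷ʳ P a = [ a ] , refl

localDist : List Corner → LocalEdge → List Corner → Corner → ℕ
localDist X (edge u i) B z = dist X u B z ⊓ dist X (flip i u) B z
localDist X up         B z = dist (parentAddress X) (attachCorner X) B z ⊓ dist X c₀ B z

localDist-up : ∀ P a B z → localDist (P ∷ʳ a) up B z ≡ dist P a B z ⊓ dist (P ∷ʳ a) c₀ B z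
localDist-up P a B z rewrite parentAddress-∷ʳ P a | attachCorner-∷ʳ P a = refl

localDist-self : ∀ X a c → localDist X a X c ≡ cornerDist a c
localDist-self X (edge u i) c = cong₂ _⊓_ (dist-self X u c) (dist-self X (flip i u) c)
localDist-self X up c with initLast X
... | []      = ⊓-idem (weight c)
... | P ∷ʳ′ a rewrite localDist-up P a (P ∷ʳ a) c | dist-ancestor P a a [] c | hamming-refl a
                    | dist-self (P ∷ʳ a) c₀ c = m≥n⇒m⊓n≡n (n≤1+n (weight c))

localDist-self-≢ : ∀ X a₁ a₂ c → cornerDist a₁ c ≢ cornerDist a₂ c →
                   localDist X a₁ X c ≢ localDist X a₂ X c
localDist-self-≢ X a₁ a₂ c = subst₂ _≢_ (sym (localDist-self X a₁ c)) (sym (localDist-self X a₂ c))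

localDist-below : ∀ X a L c T y → ¬ (L ∷ʳ c ≼ X) → localDist X a (L ++ c ∷ T) y ≡ climb T y + localDist X a L c
localDist-below X (edge u i) L c T y ∉
  rewrite dist-belowʳ X u L c T y ∉ | dist-belowʳ X (flip i u) L c T y ∉ =
  sym (+-distribˡ-⊓ (climb T y) (dist X u L c) (dist X (flip i u) L c))
localDist-below X up L c T y ∉
  rewrite dist-belowʳ (parentAddress X) (attachCorner X) L c T y (λ ≼P → ∉ (≼-trans ≼P (parentAddress-≼ X)))
        | dist-belowʳ X c₀ L c T y ∉ =
  sym (+-distribˡ-⊓ (climb T y) (dist (parentAddress X) (attachCorner X) L c) (dist X c₀ L c))

localDist-descendant : ∀ X a c S y → localDist X a (X ++ c ∷ S) y ≡ climb S y + cornerDist a c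
localDist-descendant X a c S y =
  trans (localDist-below X a X c S y (∷ʳ-⋠ X c)) (cong (climb S y +_) (localDist-self X a c))

localDist-outside : ∀ P a b B z → ¬ (P ∷ʳ a ≼ B) → localDist (P ∷ʳ a) b B z ≡ edgeClimb b + dist P a B z
localDist-outside P a (edge u i) B z ∉ rewrite dist-below P a [] u B z ∉ | dist-below P a [] (flip i u) B z ∉ =
  sym (+-distribʳ-⊓ (dist P a B z) (suc (weight u)) (suc (weight (flip i u))))
localDist-outside P a up B z ∉ rewrite localDist-up P a B z | dist-below P a [] c₀ B z ∉ =
  m≤n⇒m⊓n≡m (n≤1+n _)

far-from-outside : ∀ X a P c y → ¬ (P ∷ʳ c ≼ X) → suc (weight y) ≤ localDist X a (P ∷ʳ c) y
far-from-outside X a P c y ∉ = case a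
  where
  endpoint : ∀ B z → ¬ (P ∷ʳ c ≼ B) → suc (weight y) ≤ dist B z (P ∷ʳ c) y
  endpoint B z ∉B rewrite dist-belowʳ B z P c [] y ∉B = m≤m+n (suc (weight y)) _
  case : ∀ a → suc (weight y) ≤ localDist X a (P ∷ʳ c) y
  case (edge u i) = ⊓-glb (endpoint X u ∉) (endpoint X (flip i u) ∉)
  case up = ⊓-glb (endpoint (parentAddress X) (attachCorner X) (λ ≼P → ∉ (≼-trans ≼P (parentAddress-≼ X))))
                  (endpoint X c₀ ∉)

cornerDist-<-outside : ∀ P a Y a₁ a₂ c → ¬ (P ∷ʳ a ≼ Y) → cornerDist a₁ c ≤ weight c →
                       cornerDist a₁ c < localDist Y a₂ (P ∷ʳ a) c
cornerDist-<-outside P a Y a₁ a₂ c ∉ near = <-≤-trans (s≤s near) (far-from-outside Y a₂ P a c ∉)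

own-corner-nearer : ∀ P a Y a₁ a₂ c → ¬ (P ∷ʳ a ≼ Y) → cornerDist a₁ c ≤ weight c →
                    localDist (P ∷ʳ a) a₁ (P ∷ʳ a) c < localDist Y a₂ (P ∷ʳ a) c
own-corner-nearer P a Y a₁ a₂ c ∉ near =
  subst (_< localDist Y a₂ (P ∷ʳ a) c) (sym (localDist-self (P ∷ʳ a) a₁ c))
        (cornerDist-<-outside P a Y a₁ a₂ c ∉ near)

other-branch-far : ∀ a L b T' c T y → c ≢ b → climb T y + hamming b c ≤ localDist (L ++ b ∷ T') a (L ++ c ∷ T) y
other-branch-far a L b T' c T y c≢b = case a T'
  where
  ∉ : ∀ T' → ¬ (L ∷ʳ c ≼ L ++ b ∷ T')
  ∉ T' (T'' , e) = c≢b (sym (∷-injectiveˡ (++-cancelˡ L (b ∷ T') (c ∷ T'') (trans e (∷ʳ-++ L c T'')))))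
  below-b : ∀ T' z → climb T y + hamming b c ≤ dist (L ++ b ∷ T') z (L ++ c ∷ T) y
  below-b T' z rewrite dist-belowʳ (L ++ b ∷ T') z L c T y (∉ T') | dist-sym (L ++ b ∷ T') z L c
                     | dist-ancestor L c b T' z | hamming-sym c b =
    +-monoʳ-≤ (climb T y) (m≤m+n (hamming b c) (climb T' z))
  at-b : climb T y + hamming b c ≤ dist L b (L ++ c ∷ T) y
  at-b rewrite dist-belowʳ L b L c T y (∷ʳ-⋠ L c) | dist-self L b c = ≤-refl
  case : ∀ a T' → climb T y + hamming b c ≤ localDist (L ++ b ∷ T') a (L ++ c ∷ T) y
  case (edge u i) T' = ⊓-glb (below-b T' u) (below-b T' (flip i u))
  case up T' with initLast T'
  ... | []       rewrite localDist-up L b (L ++ c ∷ T) y = ⊓-glb at-b (below-b [] c₀)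
  ... | T₀ ∷ʳ′ t rewrite sym (++-assoc L (b ∷ T₀) [ t ]) | localDist-up (L ++ b ∷ T₀) t (L ++ c ∷ T) y =
    ⊓-glb (below-b T₀ t) (subst (λ X → climb T y + hamming b c ≤ dist X c₀ (L ++ c ∷ T) y)
                                (sym (++-assoc L (b ∷ T₀) [ t ])) (below-b (T₀ ∷ʳ t) c₀))

-- Cubes

address : ∀ {d} → Cube d → List Corner
address central       = []
address (child p c _) = address p ∷ʳ c

length-address : ∀ {d} (p : Cube d) → length (address p) ≡ d
length-address central       = refl
length-address (child p c _) = trans (length-∷ʳ (address p) c) (cong suc (length-address p))

address-injective : ∀ {d e} (p : Cube d) (q : Cube e) → address p ≡ address q → _≡_ {A = Σ ℕ Cube} (d , p) (e , q)
address-injective central       central         _  = refl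
address-injective central       (child q c _)   eq = ⊥-elim (++∷≢[] (address q) c [] (sym eq))
address-injective (child p c _) central         eq = ⊥-elim (++∷≢[] (address p) c [] eq)
address-injective (child p c f) (child q c' f') eq with ∷ʳ-injective (address p) (address q) eq
... | p≡q , refl with address-injective p q p≡q
... | refl = cong (λ f → _ , child p c f) (T-irrelevant f f')

isFree-≢c₀ : ∀ {d} (p : Cube d) c → c ≢ c₀ → T (isFree p c)
isFree-≢c₀ central       c                       _    = tt
isFree-≢c₀ (child _ _ _) (false , false , false) c≢c₀ = c≢c₀ refl
isFree-≢c₀ (child _ _ _) (false , false , true)  _    = tt
isFree-≢c₀ (child _ _ _) (false , true  , _)     _    = tt
isFree-≢c₀ (child _ _ _) (true  , _     , _)     _    = tt

isFree⇒≢c₀ : ∀ {d} (p : Cube (suc d)) c → T (isFree p c) → c ≢ c₀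
isFree⇒≢c₀ (child _ _ _) _ free refl = free

branch-isFree : ∀ {d e} (p : Cube d) (q : Cube e) b S → address q ≡ address p ++ b ∷ S → T (isFree p b)
branch-isFree p q b S eq with initLast S
branch-isFree p central         b _ eq | []       = ⊥-elim (++∷≢[] (address p) b [] (sym eq))
branch-isFree p (child q c f)   b _ eq | []       with ∷ʳ-injective (address q) (address p) eq
... | q≡p , refl with address-injective q p q≡p
... | refl = f
branch-isFree p central         b _ eq | T₀ ∷ʳ′ t =
  ⊥-elim (++∷≢[] (address p ++ b ∷ T₀) t [] (trans (++-assoc (address p) (b ∷ T₀) [ t ]) (sym eq)))
branch-isFree p (child q c f)   b _ eq | T₀ ∷ʳ′ t =
  branch-isFree p q b T₀ (proj₁ (∷ʳ-injective (address q) (address p ++ b ∷ T₀)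
                                   (trans eq (sym (++-assoc (address p) (b ∷ T₀) [ t ])))))

branch-≢c₀ : ∀ {d e} (p : Cube d) (q : Cube e) b S → address q ≡ address p ++ b ∷ S →
             address p ≢ [] → b ≢ c₀
branch-≢c₀ central       q b S _  p≢[] = ⊥-elim (p≢[] refl)
branch-≢c₀ (child p c f) q b S eq _    = isFree⇒≢c₀ (child p c f) b (branch-isFree (child p c f) q b S eq)

ones : Corner
ones = (true , true , true)

isFree-ones : ∀ {d} (p : Cube d) → T (isFree p ones)
isFree-ones central       = tt
isFree-ones (child _ _ _) = tt

descendant : ∀ {d} (p : Cube d) c → T (isFree p c) → ∀ k → d < k →
             Σ (Cube k) λ q → ∃ λ S → address q ≡ address p ++ c ∷ S
descendant p c free (suc k) (s≤s d≤k) with m≤n⇒m<n∨m≡n d≤k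
... | inj₂ refl = child p c free , [] , refl
... | inj₁ d<k with q , S , eq ← descendant p c free k d<k =
  child q ones (isFree-ones q) , S ∷ʳ ones , trans (cong (_∷ʳ ones) eq) (++-assoc (address p) (c ∷ S) [ ones ])

childIf : ∀ {d} (p : Cube d) c (b : Bool) → (T b → T (isFree p c)) → List (Cube (suc d))
childIf p c true  free = [ child p c (free tt) ]
childIf p c false _    = []

childAt : ∀ {d} (p : Cube d) → Corner → List (Cube (suc d))
childAt p c = childIf p c (isFree p c) (λ free → free)

children : ∀ {d} → Cube d → List (Cube (suc d))
children p = concatMap (childAt p) allCorners

cubesAt : ∀ d → List (Cube d)
cubesAt zero    = [ central ]
cubesAt (suc d) = concatMap children (cubesAt d)

∈-childAt : ∀ {d} (p : Cube d) c f → child p c f ∈ childAt p c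
∈-childAt p c f = ∈-childIf (isFree p c) (λ free → free) f
  where
  ∈-childIf : ∀ b g → T b → child p c f ∈ childIf p c b g
  ∈-childIf true g _ = here (cong (child p c) (T-irrelevant f (g tt)))

∈-childAt⁻ : ∀ {d} (p : Cube d) c {q} → q ∈ childAt p c → ∃ λ f → q ≡ child p c f
∈-childAt⁻ p c = ∈-childIf⁻ (isFree p c) (λ free → free)
  where
  ∈-childIf⁻ : ∀ b g {q} → q ∈ childIf p c b g → ∃ λ f → q ≡ child p c f
  ∈-childIf⁻ true g (here refl) = g tt , refl

∈-children⁻ : ∀ {d} (p : Cube d) {q} → q ∈ children p → ∃₂ λ c f → q ≡ child p c f
∈-children⁻ p q∈ with c , _ , q∈c ← find (∈-concatMap⁻ (childAt p) {xs = allCorners} q∈) =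
  c , ∈-childAt⁻ p c q∈c

∈-cubesAt : ∀ {d} (q : Cube d) → q ∈ cubesAt d
∈-cubesAt central       = here refl
∈-cubesAt (child p c f) =
  ∈-concatMap children (∈-cubesAt p) (∈-concatMap (childAt p) (allCorners-complete c) (∈-childAt p c f))

unique-childAt : ∀ {d} (p : Cube d) c → Unique (childAt p c)
unique-childAt p c = unique-childIf (isFree p c) (λ free → free)
  where
  unique-childIf : ∀ b g → Unique (childIf p c b g)
  unique-childIf true  g = All.[] AllPairs.∷ AllPairs.[]
  unique-childIf false g = AllPairs.[]

unique-cubesAt : ∀ d → Unique (cubesAt d)
unique-cubesAt zero    = All.[] AllPairs.∷ AllPairs.[]
unique-cubesAt (suc d) = unique-concatMap children same-parent unique-children (unique-cubesAt d)
  where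
  same-corner : ∀ {p : Cube d} {c c' q} → q ∈ childAt p c → q ∈ childAt p c' → c ≡ c'
  same-corner {p} {c} {c'} q∈ q∈' with ∈-childAt⁻ p c q∈ | ∈-childAt⁻ p c' q∈'
  ... | _ , refl | _ , refl = refl
  unique-children : ∀ p → Unique (children p)
  unique-children p = unique-concatMap (childAt p) same-corner (unique-childAt p)
                        (from-yes (DecUnique.unique? _≟ᶜ_ allCorners))
  same-parent : ∀ {p p' q} → q ∈ children p → q ∈ children p' → p ≡ p'
  same-parent {p} {p'} q∈ q∈' with ∈-children⁻ p q∈ | ∈-children⁻ p' q∈'
  ... | _ , _ , refl | _ , _ , refl = refl

length-cubesAt : ∀ d → length (cubesAt (suc d)) ≡ 8 * 7 ^ d
length-cubesAt zero    = refl
length-cubesAt (suc d) = begin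
  length (concatMap children (cubesAt (suc d))) ≡⟨ length-concatMap children 7 seven (cubesAt (suc d)) ⟩
  length (cubesAt (suc d)) * 7                  ≡⟨ cong (_* 7) (length-cubesAt d) ⟩
  8 * 7 ^ d * 7                                 ≡⟨ *-assoc 8 (7 ^ d) 7 ⟩
  8 * (7 ^ d * 7)                               ≡⟨ cong (8 *_) (*-comm (7 ^ d) 7) ⟩
  8 * 7 ^ suc d                                 ∎
  where
  open ≡-Reasoning
  seven : (q : Cube (suc d)) → length (children q) ≡ 7
  seven (child _ _ _) = refl

-- Distances in CCS(n)

module Distances (n : ℕ) where

  Vertex : Set
  Vertex = Graph.V (CCS n)

  vertex : ∀ {d} → Cube d → Corner → d < n → Vertex
  vertex {d} p c d<n = pos d p c , d<n

  addressOf : Vertex → List Corner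
  addressOf (pos _ p _ , _) = address p

  cornerOf : Vertex → Corner
  cornerOf (pos _ _ c , _) = c

  length-addressOf< : ∀ h → length (addressOf h) < n
  length-addressOf< (pos _ p _ , d<n) = subst (_< n) (sym (length-address p)) d<n

  distance : Vertex → Vertex → ℕ
  distance x h = dist (addressOf x) (cornerOf x) (addressOf h) (cornerOf h)

  distance-adj : ∀ {x y} → Graph.Adj (CCS n) x y → ∀ h → Near (distance x h) (distance y h)
  distance-adj (cubeEdge {p = p} q)        h = dist-cubeEdge q (address p) (addressOf h) (cornerOf h)
  distance-adj (bridge↓ {p = p} {c = c} _) h = dist-bridge (address p) c (addressOf h) (cornerOf h)
  distance-adj (bridge↑ {p = p} {c = c} _) h = near-sym (dist-bridge (address p) c (addressOf h) (cornerOf h))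

  distance-≤-walk : ∀ {x h m} → Walk (CCS n) x h m → distance x h ≤ m
  distance-≤-walk {x} here =
    ≤-reflexive (trans (dist-self (addressOf x) (cornerOf x) (cornerOf x)) (hamming-refl (cornerOf x)))
  distance-≤-walk {x} {h} (step {w = w} x~w w⇝h) =
    ≤-trans (proj₁ (distance-adj {x} {w} x~w h)) (s≤s (distance-≤-walk w⇝h))

  infixl 5 _++ʷ_

  _++ʷ_ : ∀ {x y z m k} → Walk (CCS n) x y m → Walk (CCS n) y z k → Walk (CCS n) x z (m + k)
  here       ++ʷ w' = w'
  step x~w w ++ʷ w' = step x~w (w ++ʷ w')

  substʷ : ∀ {x y m k} → m ≡ k → Walk (CCS n) x y m → Walk (CCS n) x y k
  substʷ refl w = w

  walk-inCube : ∀ {d} (p : Cube d) (d<n : d < n) y z → Walk (CCS n) (vertex p y d<n) (vertex p z d<n) (hamming y z)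
  walk-inCube p d<n (x , y , z) (x' , y' , z') = along₁ x x' ++ʷ along₂ y y' ++ʷ along₃ z z'
    where
    along₁ : ∀ x x' → Walk (CCS n) (vertex p (x , y , z) d<n) (vertex p (x' , y , z) d<n) (bitDist x x')
    along₁ false false = here
    along₁ true  true  = here
    along₁ false true  = step (cubeEdge (flip₁ false y z)) here
    along₁ true  false = step (cubeEdge (flip₁ true y z)) here
    along₂ : ∀ y y' → Walk (CCS n) (vertex p (x' , y , z) d<n) (vertex p (x' , y' , z) d<n) (bitDist y y')
    along₂ false false = here
    along₂ true  true  = here
    along₂ false true  = step (cubeEdge (flip₂ x' false z)) here
    along₂ true  false = step (cubeEdge (flip₂ x' true z)) here
    along₃ : ∀ z z' → Walk (CCS n) (vertex p (x' , y' , z) d<n) (vertex p (x' , y' , z') d<n) (bitDist z z')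
    along₃ false false = here
    along₃ true  true  = here
    along₃ false true  = step (cubeEdge (flip₃ x' y' false)) here
    along₃ true  false = step (cubeEdge (flip₃ x' y' true)) here

  walk-up : ∀ {d} (p : Cube d) c f y (d+1<n : suc d < n) →
            Walk (CCS n) (vertex (child p c f) y d+1<n) (vertex p c (<⇒≤ d+1<n)) (climb [] y)
  walk-up p c f y d+1<n = substʷ (trans (+-comm (hamming y c₀) 1) (cong suc (hamming-sym y c₀)))
    (walk-inCube (child p c f) d+1<n y c₀ ++ʷ step (bridge↑ f) here)

  walk-down : ∀ {d} (p : Cube d) c f z (d+1<n : suc d < n) →
              Walk (CCS n) (vertex p c (<⇒≤ d+1<n)) (vertex (child p c f) z d+1<n) (climb [] z)
  walk-down p c f z d+1<n = step (bridge↓ f) (walk-inCube (child p c f) d+1<n c₀ z)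

  walk : ∀ {d e} (p : Cube d) y (q : Cube e) z (d<n : d < n) (e<n : e < n) →
         Walk (CCS n) (vertex p y d<n) (vertex q z e<n) (dist (address p) y (address q) z)
  walk p y q z d<n e<n with address p ≼? address q
  walk central       y q z d<n e<n | no ∉ = ⊥-elim (∉ (address q , refl))
  walk (child p c f) y q z d<n e<n | no ∉ =
    substʷ (sym (dist-below (address p) c [] y (address q) z ∉))
      (walk-up p c f y d<n ++ʷ walk p c q z (<⇒≤ d<n) e<n)
  walk p y q z d<n e<n | yes ([] , eq) with address-injective p q (trans (sym (++-identityʳ (address p))) (sym eq))
  ... | refl rewrite <-irrelevant e<n d<n =
    substʷ (sym (dist-self (address p) y z)) (walk-inCube p d<n y z)
  walk p y central       z d<n e<n | yes (t ∷ S , eq) = ⊥-elim (++∷≢[] (address p) t S (sym eq))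
  walk p y (child q c f) z d<n e<n | yes (t ∷ S , eq) =
    substʷ (trans (+-comm _ (climb [] z)) (sym (dist-belowʳ (address p) y (address q) c [] z ∉)))
      (walk p y q c d<n (<⇒≤ e<n) ++ʷ walk-down q c f z e<n)
    where
    ∉ : ¬ (address q ∷ʳ c ≼ address p)
    ∉ = ⋠-shorter (subst (length (address p) <_) (sym (cong length eq)) (length-<-++∷ (address p) t S))

  distance-isDist : ∀ x h → Dist (CCS n) x h (distance x h)
  distance-isDist (pos _ p y , d<n) (pos _ q z , e<n) = walk p y q z d<n e<n , λ _ → distance-≤-walk

  Dist⇒≡distance : ∀ {x h k} → Dist (CCS n) x h k → k ≡ distance x h
  Dist⇒≡distance {x} {h} (w , shortest) = ≤-antisym (shortest _ (proj₁ (distance-isDist x h))) (distance-≤-walk w)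

  edgeDistance : Edge (CCS n) → Vertex → ℕ
  edgeDistance ((a , b) , _) h = distance a h ⊓ distance b h

  edgeDistance-isEdgeDist : ∀ e h → EdgeDist (CCS n) e h (edgeDistance e h)
  edgeDistance-isEdgeDist ((a , b) , _) h = distance a h , distance b h , distance-isDist a h , distance-isDist b h , refl

  EdgeDist⇒≡edgeDistance : ∀ e h {k} → EdgeDist (CCS n) e h k → k ≡ edgeDistance e h
  EdgeDist⇒≡edgeDistance ((a , b) , _) h (_ , _ , da , db , refl) =
    cong₂ _⊓_ (Dist⇒≡distance da) (Dist⇒≡distance db)

  distinguishes⁺ : ∀ h e₁ e₂ → edgeDistance e₁ h ≢ edgeDistance e₂ h → Distinguishes (CCS n) h e₁ e₂
  distinguishes⁺ h e₁ e₂ ≢ = _ , _ , edgeDistance-isEdgeDist e₁ h , edgeDistance-isEdgeDist e₂ h , ≢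

  distinguishes⁻ : ∀ h e₁ e₂ → Distinguishes (CCS n) h e₁ e₂ → edgeDistance e₁ h ≢ edgeDistance e₂ h
  distinguishes⁻ h e₁ e₂ (_ , _ , d₁ , d₂ , ≢) eq =
    ≢ (trans (EdgeDist⇒≡edgeDistance e₁ h d₁) (trans eq (sym (EdgeDist⇒≡edgeDistance e₂ h d₂))))

  -- The home of a cube edge is its cube, that of a bridge the cube below it.
  record Home (e : Edge (CCS n)) : Set where
    field
      {depth}       : ℕ
      cube          : Cube depth
      depth<n       : depth < n
      local         : LocalEdge
      up-nonCentral : local ≡ up → address cube ≢ []
      edgeDistance≡ : ∀ h → edgeDistance e h ≡ localDist (address cube) local (addressOf h) (cornerOf h)

  home : ∀ e → Home e
  home ((x , y) , cubeEdge {p = p} {c} q) = record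
    { cube = p ; depth<n = proj₂ x ; local = edge c (axisOf q) ; up-nonCentral = λ ()
    ; edgeDistance≡ = λ h → cong (λ c' → dist (address p) c (addressOf h) (cornerOf h) ⊓
                                         dist (address p) c' (addressOf h) (cornerOf h))
                                  (axisOf-flip q) }
  home ((x , y) , bridge↓ {p = p} {c} f) = record
    { cube = child p c f ; depth<n = proj₂ y ; local = up ; up-nonCentral = λ _ → ++∷≢[] (address p) c []
    ; edgeDistance≡ = λ h → sym (localDist-up (address p) c (addressOf h) (cornerOf h)) }
  home ((x , y) , bridge↑ {p = p} {c} f) = record
    { cube = child p c f ; depth<n = proj₂ x ; local = up ; up-nonCentral = λ _ → ++∷≢[] (address p) c []
    ; edgeDistance≡ = λ h → trans (⊓-comm (distance x h) (distance y h))
                                   (sym (localDist-up (address p) c (addressOf h) (cornerOf h))) }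

  vertex-≡ : ∀ {d} (p : Cube d) {c c'} {d<n d<n' : d < n} → c ≡ c' → vertex p c d<n ≡ vertex p c' d<n'
  vertex-≡ p {d<n = d<n} {d<n'} refl = cong (vertex p _) (<-irrelevant d<n d<n')

  same-home⇒SameEdge : ∀ e₁ e₂ → let open Home (home e₁) renaming (cube to O₁; local to a₁)
                                     open Home (home e₂) renaming (cube to O₂; local to a₂)
                                 in address O₁ ≡ address O₂ → SameLocalEdge a₁ a₂ → SameEdge (CCS n) e₁ e₂
  same-home⇒SameEdge (_ , cubeEdge {p = p} {c} {c'} q) (_ , cubeEdge {p = p₂} {c₂} {c₂'} q₂) eqA (i≡j , same)
    with address-injective p p₂ eqA
  ... | refl with same
  ... | inj₁ c₂≡c = inj₁ (vertex-≡ p (sym c₂≡c) ,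
          vertex-≡ p (trans (axisOf-flip q) (trans (cong₂ flip i≡j (sym c₂≡c)) (sym (axisOf-flip q₂)))))
  ... | inj₂ c₂≡c' = inj₂
          (vertex-≡ p (sym (trans (axisOf-flip q₂) (trans (cong₂ flip (sym i≡j) c₂≡c') (flip-involutive _ c)))) ,
          vertex-≡ p (trans (axisOf-flip q) (sym c₂≡c')))
  same-home⇒SameEdge (_ , bridge↓ {p = p} {c} f) (_ , bridge↓ {p = p₂} {c₂} f₂) eqA _
    with address-injective (child p c f) (child p₂ c₂ f₂) eqA
  ... | refl = inj₁ (vertex-≡ p refl , vertex-≡ (child p c f) refl)
  same-home⇒SameEdge (_ , bridge↓ {p = p} {c} f) (_ , bridge↑ {p = p₂} {c₂} f₂) eqA _
    with address-injective (child p c f) (child p₂ c₂ f₂) eqA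
  ... | refl = inj₂ (vertex-≡ p refl , vertex-≡ (child p c f) refl)
  same-home⇒SameEdge (_ , bridge↑ {p = p} {c} f) (_ , bridge↓ {p = p₂} {c₂} f₂) eqA _
    with address-injective (child p c f) (child p₂ c₂ f₂) eqA
  ... | refl = inj₂ (vertex-≡ (child p c f) refl , vertex-≡ p refl)
  same-home⇒SameEdge (_ , bridge↑ {p = p} {c} f) (_ , bridge↑ {p = p₂} {c₂} f₂) eqA _
    with address-injective (child p c f) (child p₂ c₂ f₂) eqA
  ... | refl = inj₁ (vertex-≡ (child p c f) refl , vertex-≡ p refl)

-- The upper and the lower bound

module Bounds (m : ℕ) where
  open Distances (suc (suc m))

  outerCubes : List (Cube (suc m))
  outerCubes = cubesAt (suc m)

  landmark : Cube (suc m) → Corner → Vertex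
  landmark Q c = vertex Q c ≤-refl

  landmarks : Cube (suc m) → List Vertex
  landmarks Q = landmark Q α ∷ landmark Q β ∷ []

  H : List Vertex
  H = concatMap landmarks outerCubes

  α∈H : ∀ Q → landmark Q α ∈ H
  α∈H Q = ∈-concatMap landmarks (∈-cubesAt Q) (here refl)

  β∈H : ∀ Q → landmark Q β ∈ H
  β∈H Q = ∈-concatMap landmarks (∈-cubesAt Q) (there (here refl))

  Separated : List Corner → LocalEdge → List Corner → LocalEdge → Set
  Separated X₁ a₁ X₂ a₂ =
    ∃ λ h → h ∈ H × localDist X₁ a₁ (addressOf h) (cornerOf h) ≢ localDist X₂ a₂ (addressOf h) (cornerOf h)

  outer-outside : ∀ X → X ≢ [] → Σ (Cube (suc m)) λ Q → ¬ (X ≼ address Q)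
  outer-outside []      X≢[] = ⊥-elim (X≢[] refl)
  outer-outside (b ∷ X) _    with Q , S , eq ← descendant central (flip ax₁ b) tt (suc m) (s≤s z≤n) =
    Q , λ (_ , e) → flip-≢ ax₁ b (∷-injectiveˡ (trans (sym eq) e))

  separate-outer-same : ∀ (Q : Cube (suc m)) a₁ a₂ → ¬ SameLocalEdge a₁ a₂ → Separated (address Q) a₁ (address Q) a₂
  separate-outer-same Q@(child P a _) a₁ a₂ a₁≁a₂ with separated-by-α-β-climb a₁ a₂ a₁≁a₂
  ... | inj₁ α-sep            = landmark Q α , α∈H Q , localDist-self-≢ (address Q) a₁ a₂ α α-sep
  ... | inj₂ (inj₁ β-sep)     = landmark Q β , β∈H Q , localDist-self-≢ (address Q) a₁ a₂ β β-sep
  ... | inj₂ (inj₂ climb-sep) with Q' , ∉ ← outer-outside (address Q) (++∷≢[] (address P) a []) =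
    landmark Q' α , α∈H Q' , λ eq → climb-sep (+-cancelʳ-≡ (dist (address P) a (address Q') α) _ _ (begin
      edgeClimb a₁ + dist (address P) a (address Q') α   ≡⟨ localDist-outside (address P) a a₁ (address Q') α ∉ ⟨
      localDist (address P ∷ʳ a) a₁ (address Q') α       ≡⟨ eq ⟩
      localDist (address P ∷ʳ a) a₂ (address Q') α       ≡⟨ localDist-outside (address P) a a₂ (address Q') α ∉ ⟩
      edgeClimb a₂ + dist (address P) a (address Q') α   ∎))
    where open ≡-Reasoning

  separate-outer-other : ∀ (Q : Cube (suc m)) {d} (O : Cube d) → ¬ (address Q ≼ address O) →
                         ∀ a₁ a₂ → Separated (address Q) a₁ (address O) a₂
  separate-outer-other Q@(child P a _) O Q⋠O a₁ a₂ with near-α-or-β a₁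
  ... | inj₁ near = landmark Q α , α∈H Q , <⇒≢ (own-corner-nearer (address P) a (address O) a₁ a₂ α Q⋠O near)
  ... | inj₂ near = landmark Q β , β∈H Q , <⇒≢ (own-corner-nearer (address P) a (address O) a₁ a₂ β Q⋠O near)

  -- Outer cubes hang below every free corner of every inner cube, so the α corners
  -- in H can play the role of landmarks placed anywhere below such a corner.
  separated-below : ∀ {d} (O : Cube d) c → c ≢ c₀ → d < suc m → ∀ X₁ a₁ X₂ a₂ →
                    (∀ S → localDist X₁ a₁ (address O ++ c ∷ S) α ≢ localDist X₂ a₂ (address O ++ c ∷ S) α) →
                    Separated X₁ a₁ X₂ a₂
  separated-below O c c≢c₀ d<m X₁ a₁ X₂ a₂ sep
    with Q , S , eq ← descendant O c (isFree-≢c₀ O c c≢c₀) (suc m) d<m =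
    landmark Q α , α∈H Q , subst (λ B → localDist X₁ a₁ B α ≢ localDist X₂ a₂ B α) (sym eq) (sep S)

  separate-inner-same : ∀ {d} (O : Cube d) → d < suc m → ∀ a₁ a₂ → ¬ SameLocalEdge a₁ a₂ →
                        Separated (address O) a₁ (address O) a₂
  separate-inner-same O d<m a₁ a₂ a₁≁a₂ with c , c≢c₀ , c-sep ← separated-by-free-corner a₁ a₂ a₁≁a₂ =
    separated-below O c c≢c₀ d<m (address O) a₁ (address O) a₂ λ S eq → c-sep (+-cancelˡ-≡ (climb S α) _ _ (begin
      climb S α + cornerDist a₁ c              ≡⟨ localDist-descendant (address O) a₁ c S α ⟨
      localDist (address O) a₁ (address O ++ c ∷ S) α ≡⟨ eq ⟩
      localDist (address O) a₂ (address O ++ c ∷ S) α ≡⟨ localDist-descendant (address O) a₂ c S α ⟩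
      climb S α + cornerDist a₂ c              ∎))
    where open ≡-Reasoning

  separate-inner-ancestor : ∀ {d} (O : Cube d) → d < suc m → ∀ b S' a₁ a₂ → (a₁ ≡ up → b ≢ c₀) →
                            Separated (address O) a₁ (address O ++ b ∷ S') a₂
  separate-inner-ancestor O d<m b S' a₁ a₂ up⇒b≢c₀
    with c , c≢c₀ , c≢b , nearer ← nearer-than-branch a₁ b up⇒b≢c₀ =
    separated-below O c c≢c₀ d<m (address O) a₁ (address O ++ b ∷ S') a₂ λ S → <⇒≢ (begin-strict
      localDist (address O) a₁ (address O ++ c ∷ S) α         ≡⟨ localDist-descendant (address O) a₁ c S α ⟩
      climb S α + cornerDist a₁ c                              <⟨ +-monoʳ-< (climb S α) nearer ⟩
      climb S α + hamming b c                                  ≤⟨ other-branch-far a₂ (address O) b S' c S α c≢b ⟩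
      localDist (address O ++ b ∷ S') a₂ (address O ++ c ∷ S) α ∎)
    where open ≤-Reasoning

  separate-inner-outside : ∀ {d} (O : Cube (suc d)) → suc d < suc m → ∀ Y → ¬ (address O ≼ Y) → ∀ a₁ a₂ →
                           Separated (address O) a₁ Y a₂
  separate-inner-outside O@(child P a _) d<m Y O⋠Y a₁ a₂ with c , c≢c₀ , near ← within-weight a₁ =
    separated-below O c c≢c₀ d<m (address O) a₁ Y a₂ λ S → <⇒≢ (begin-strict
      localDist (address O) a₁ (address O ++ c ∷ S) α   ≡⟨ localDist-descendant (address O) a₁ c S α ⟩
      climb S α + cornerDist a₁ c
        <⟨ +-monoʳ-< (climb S α) (cornerDist-<-outside (address P) a Y a₁ a₂ c O⋠Y near) ⟩
      climb S α + localDist Y a₂ (address O) c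
        ≡⟨ localDist-below Y a₂ (address O) c S α (λ Oc≼Y → O⋠Y (∷ʳ-≼ c Oc≼Y)) ⟨
      localDist Y a₂ (address O ++ c ∷ S) α              ∎)
    where open ≤-Reasoning

  separate-homes : ∀ {d₁ d₂} (O₁ : Cube d₁) (O₂ : Cube d₂) → d₁ < suc (suc m) → d₂ < suc (suc m) → ∀ a₁ a₂ →
                   (a₁ ≡ up → address O₁ ≢ []) → ¬ (address O₁ ≡ address O₂ × SameLocalEdge a₁ a₂) →
                   Separated (address O₁) a₁ (address O₂) a₂
  separate-homes {d₁} O₁ O₂ d₁<n d₂<n a₁ a₂ up-nonCentral distinct with address O₁ ≼? address O₂
  ... | yes ([] , eq) =
    subst (λ X → Separated (address O₁) a₁ X a₂) (sym (trans eq (++-identityʳ _))) (same (≤-pred d₁<n))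
    where
    a₁≁a₂ : ¬ SameLocalEdge a₁ a₂
    a₁≁a₂ same = distinct (sym (trans eq (++-identityʳ _)) , same)
    same : d₁ ≤ suc m → Separated (address O₁) a₁ (address O₁) a₂
    same d₁≤ with m≤n⇒m<n∨m≡n d₁≤
    ... | inj₁ d₁<m = separate-inner-same O₁ d₁<m a₁ a₂ a₁≁a₂
    ... | inj₂ refl = separate-outer-same O₁ a₁ a₂ a₁≁a₂
  ... | yes (b ∷ S' , eq) = subst (λ X → Separated (address O₁) a₁ X a₂) (sym eq)
    (separate-inner-ancestor O₁ d₁<m b S' a₁ a₂ λ a₁≡up → branch-≢c₀ O₁ O₂ b S' eq (up-nonCentral a₁≡up))
    where
    d₁<m : d₁ < suc m
    d₁<m = <-≤-trans (subst₂ _<_ (length-address O₁) (trans (cong length (sym eq)) (length-address O₂))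
                               (length-<-++∷ (address O₁) b S'))
                     (≤-pred d₂<n)
  ... | no O₁⋠O₂ = outside O₁ (≤-pred d₁<n) O₁⋠O₂
    where
    outside : ∀ {d} (O : Cube d) → d ≤ suc m → ¬ (address O ≼ address O₂) →
              Separated (address O) a₁ (address O₂) a₂
    outside central           _  O⋠O₂ = ⊥-elim (O⋠O₂ (_ , refl))
    outside O@(child _ _ _) d≤m O⋠O₂ with m≤n⇒m<n∨m≡n d≤m
    ... | inj₁ d<m  = separate-inner-outside O d<m (address O₂) O⋠O₂ a₁ a₂
    ... | inj₂ refl = separate-outer-other O O₂ O⋠O₂ a₁ a₂

  H-generates : IsEdgeMetricGenerator (CCS (suc (suc m))) H
  H-generates e₁ e₂ e₁≠e₂ = distinguish (separate-homes O₁ O₂ d₁<n d₂<n a₁ a₂ up-nonCentral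
                                          λ (eqA , same) → e₁≠e₂ (same-home⇒SameEdge e₁ e₂ eqA same))
    where
    open Home (home e₁) renaming (cube to O₁; depth<n to d₁<n; local to a₁; edgeDistance≡ to edgeDistance≡₁)
    open Home (home e₂) renaming (cube to O₂; depth<n to d₂<n; local to a₂; edgeDistance≡ to edgeDistance≡₂)
                        hiding (up-nonCentral)
    distinguish : Separated (address O₁) a₁ (address O₂) a₂ →
                  ∃[ h ] (h ∈ H × Distinguishes (CCS (suc (suc m))) h e₁ e₂)
    distinguish (h , h∈H , ≢) =
      h , h∈H , distinguishes⁺ h e₁ e₂ λ eq → ≢ (trans (sym (edgeDistance≡₁ h)) (trans eq (edgeDistance≡₂ h)))

  perOuterCube-unique : (f : Cube (suc m) → List Vertex) → (∀ Q → Unique (f Q)) →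
                        (∀ Q → All (λ h → addressOf h ≡ address Q) (f Q)) → Unique (concatMap f outerCubes)
  perOuterCube-unique f unique-f inside = unique-concatMap f same-cube unique-f (unique-cubesAt (suc m))
    where
    same-cube : ∀ {Q Q' h} → h ∈ f Q → h ∈ f Q' → Q ≡ Q'
    same-cube {Q} {Q'} h∈ h∈'
      with address-injective Q Q' (trans (sym (All.lookup (inside Q) h∈)) (All.lookup (inside Q') h∈'))
    ... | refl = refl

  perOuterCube-length : (f : Cube (suc m) → List Vertex) → (∀ Q → length (f Q) ≡ 2) →
                        length (concatMap f outerCubes) ≡ 7 ^ m * 16
  perOuterCube-length f two = begin
    length (concatMap f outerCubes) ≡⟨ length-concatMap f 2 two outerCubes ⟩
    length outerCubes * 2           ≡⟨ cong (_* 2) (length-cubesAt m) ⟩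
    8 * 7 ^ m * 2                   ≡⟨ cong (_* 2) (*-comm 8 (7 ^ m)) ⟩
    7 ^ m * 8 * 2                   ≡⟨ *-assoc (7 ^ m) 8 2 ⟩
    7 ^ m * 16                      ∎
    where open ≡-Reasoning

  unique-H : Unique H
  unique-H = perOuterCube-unique landmarks (λ _ → unique-pair λ ()) (λ _ → refl All.∷ refl All.∷ All.[])

  length-H : length H ≡ 7 ^ m * 16
  length-H = perOuterCube-length landmarks λ _ → refl

  c₀-edge : Cube (suc m) → Axis → Edge (CCS (suc (suc m)))
  c₀-edge Q i = (landmark Q c₀ , landmark Q (flip i c₀)) , cubeEdge (flip-adj i c₀)

  c₀-edges-distinct : ∀ Q {i j} → i ≢ j → ¬ SameEdge (CCS (suc (suc m))) (c₀-edge Q i) (c₀-edge Q j)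
  c₀-edges-distinct Q         i≢j (inj₁ (_ , e)) = i≢j (flip-c₀-injective _ _ (cong cornerOf e))
  c₀-edges-distinct Q {j = j} _   (inj₂ (e , _)) = flip-≢ j c₀ (sym (cong cornerOf e))

  outer-⋠ : ∀ (Q : Cube (suc m)) h → addressOf h ≢ address Q → ¬ (address Q ≼ addressOf h)
  outer-⋠ Q h = ⋠-notLonger (subst (length (addressOf h) ≤_) (sym (length-address Q)) (≤-pred (length-addressOf< h)))

  -- Seen from outside Q, the edges at c₀ differ only by their climb, which is 1 for all three.
  single-corner-insufficient : ∀ H' → IsEdgeMetricGenerator (CCS (suc (suc m))) H' → ∀ (Q : Cube (suc m)) z →
                               ¬ (∀ h → h ∈ H' → addressOf h ≡ address Q → cornerOf h ≡ z)
  single-corner-insufficient H' generates Q@(child P a _) z only-z with i , j , i≢j , same-z ← c₀-edges-unseparated z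
    with h , h∈H' , sep ← generates (c₀-edge Q i) (c₀-edge Q j) (c₀-edges-distinct Q i≢j) =
    distinguishes⁻ h (c₀-edge Q i) (c₀-edge Q j) sep equal
    where
    equal : localDist (address Q) (edge c₀ i) (addressOf h) (cornerOf h) ≡
            localDist (address Q) (edge c₀ j) (addressOf h) (cornerOf h)
    equal with addressOf h ≟ᴬ address Q
    ... | yes h∈Q rewrite h∈Q | localDist-self (address Q) (edge c₀ i) (cornerOf h)
                        | localDist-self (address Q) (edge c₀ j) (cornerOf h) | only-z h h∈H' h∈Q = same-z
    ... | no h∉Q rewrite localDist-outside (address P) a (edge c₀ i) (addressOf h) (cornerOf h) (outer-⋠ Q h h∉Q)
                       | localDist-outside (address P) a (edge c₀ j) (addressOf h) (cornerOf h) (outer-⋠ Q h h∉Q)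
                       | edgeClimb-c₀ i | edgeClimb-c₀ j = refl

  vertex-avoiding : ∀ H' → IsEdgeMetricGenerator (CCS (suc (suc m))) H' → ∀ (Q : Cube (suc m)) z →
                    ∃ λ h → h ∈ H' × (addressOf h ≡ address Q × cornerOf h ≢ z)
  vertex-avoiding H' generates Q z =
    find (decidable-stable (any? (λ h → addressOf h ≟ᴬ address Q ×-dec ¬? (cornerOf h ≟ᶜ z)) H') λ none →
      single-corner-insufficient H' generates Q z λ h h∈H' h∈Q →
        decidable-stable (cornerOf h ≟ᶜ z) λ h≢z → none (lose h∈H' (h∈Q , h≢z)))

  record TwoIn (H' : List Vertex) (Q : Cube (suc m)) : Set where
    field
      h₁ h₂    : Vertex
      h₁∈H'    : h₁ ∈ H'
      h₂∈H'    : h₂ ∈ H'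
      h₁∈Q     : addressOf h₁ ≡ address Q
      h₂∈Q     : addressOf h₂ ≡ address Q
      corners≢ : cornerOf h₁ ≢ cornerOf h₂

  two-in : ∀ H' → IsEdgeMetricGenerator (CCS (suc (suc m))) H' → ∀ Q → TwoIn H' Q
  two-in H' generates Q with h₁ , h₁∈H' , h₁∈Q , _ ← vertex-avoiding H' generates Q c₀
    with h₂ , h₂∈H' , h₂∈Q , h₂≢h₁ ← vertex-avoiding H' generates Q (cornerOf h₁) =
    record { h₁∈H' = h₁∈H' ; h₂∈H' = h₂∈H' ; h₁∈Q = h₁∈Q ; h₂∈Q = h₂∈Q
           ; corners≢ = λ eq → h₂≢h₁ (sym eq) }

  lower-bound : ∀ H' → IsEdgeMetricGenerator (CCS (suc (suc m))) H' → 7 ^ m * 16 ≤ length H'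
  lower-bound H' generates = subst (_≤ length H') (perOuterCube-length pair λ _ → refl)
    (unique⊆⇒length≤ (perOuterCube-unique pair unique-pair-in inside) pairs⊆H')
    where
    module Two Q = TwoIn (two-in H' generates Q)
    pair : Cube (suc m) → List Vertex
    pair Q = Two.h₁ Q ∷ Two.h₂ Q ∷ []
    unique-pair-in : ∀ Q → Unique (pair Q)
    unique-pair-in Q = unique-pair λ eq → Two.corners≢ Q (cong cornerOf eq)
    inside : ∀ Q → All (λ h → addressOf h ≡ address Q) (pair Q)
    inside Q = Two.h₁∈Q Q All.∷ Two.h₂∈Q Q All.∷ All.[]
    pairs⊆H' : concatMap pair outerCubes ⊆ H'
    pairs⊆H' h∈ with Q , _ , h∈pair ← find (∈-concatMap⁻ pair {xs = outerCubes} h∈) with h∈pair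
    ... | here refl         = Two.h₁∈H' Q
    ... | there (here refl) = Two.h₂∈H' Q

theorem2 : (n : ℕ) → 2 ≤ n → EdgeMetricDimension (CCS n) (7 ^ (n ∸ 2) * 16)
theorem2 (suc (suc m)) (s≤s (s≤s z≤n)) = (H , unique-H , length-H , H-generates) , λ H' _ → lower-bound H'
  where open Bounds m
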